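{- Let $G=(V,E)$ be a connected finite simple graph with at least two vertices and with Cheeger constant $g$ (as defined in the context). If $k$ is a nonnegative integer with $k \le \frac{1}{2}\left\lfloor\frac{|V|}{2}\right\rfloor g$, then $G$ cannot be cleared by $k$ polite lions: for every initial placement of $k$ lions and every sequence of moves in which at most one lion moves at each time step, there is no time $t$ with $C(t)=V$.
   Context: Lions and contamination model: a set of $k$ lions occupies vertices of a finite simple graph $G=(V,E)$ (several lions may share a vertex). Time is discrete, $t=0,1,2,\dots$. Between times $t$ and $t+1$ each lion either stays at its vertex or moves along an edge to an adjacent vertex. In the polite model, at most one lion moves between times $t$ and $t+1$; all others stay in place. $C(t)\subseteq V$ denotes the set of cleared vertices at time $t$; all other vertices are contaminated. $C(0)$ is the set of vertices occupied by lions at time $0$. For $t\ge 0$, a vertex $v$ lies in $C(t+1)$ if and only if either $v$ is occupied by a lion at time $t+1$, or $v\in C(t)$ and for every vertex $u$ adjacent to $v$ with $u\notin C(t)$, some lion moves across the edge from $v$ to $u$ between times $t$ and $t+1$. The lions clear $G$ if $C(t)=V$ for some time $t$. For $S\subseteq V$, the boundary is $\partial S=\{v\in S : uv\in E \text{ for some } u\notin S\}$, and $\overline{S}=V\setminus S$. For a graph with at least two vertices, the Cheeger constant is $g=\min\left\{\frac{|\partial S|}{\min\{|S|,|\overline{S}|\}} : S\subseteq V,\ S\neq\emptyset,\ S\neq V\right\}$. -}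

module Defs where

open import Data.Nat using (ℕ; zero; suc; _+_; _<_; _⊓_; z<s; s<s; NonZero; >-nonZero)
open import Data.Nat.Properties using (⊓-pres-m<)
open import Data.Bool using (Bool; true; false; _∧_; not; if_then_else_)
open import Data.Fin using (Fin; zero; suc)
open import Data.List using (allFin)
open import Data.Bool.ListAction using (any)
open import Data.Integer using (+_)
open import Data.Rational using (ℚ; _/_)
open import Data.Product using (Σ; ∃; _×_; _,_)
open import Data.Sum using (_⊎_)
open import Relation.Binary.PropositionalEquality using (_≡_; _≢_; refl)
open import Relation.Nullary using (¬_)

record Graph (n : ℕ) : Set where
  field
    adj     : Fin n → Fin n → Bool
    symm    : ∀ u v → adj u v ≡ adj v u
    irrefl  : ∀ v → adj v v ≡ false

open Graph public

Adj : ∀ {n} → Graph n → Fin n → Fin n → Set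
Adj G u v = adj G u v ≡ true

data Reach {n} (G : Graph n) (u : Fin n) : Fin n → Set where
  here : Reach G u u
  step : ∀ {v w} → Reach G u v → Adj G v w → Reach G u w

Connected : ∀ {n} → Graph n → Set
Connected G = ∀ u v → Reach G u v

VSubset : ℕ → Set
VSubset n = Fin n → Bool

count : ∀ {n} → VSubset n → ℕ
count {zero}  S = 0
count {suc n} S = (if S zero then 1 else 0) + count (λ v → S (suc v))

compl : ∀ {n} → VSubset n → VSubset n
compl S v = not (S v)

boundary : ∀ {n} → Graph n → VSubset n → VSubset n
boundary {n} G S v = S v ∧ any (λ u → adj G v u ∧ not (S u)) (allFin n)

Proper : ∀ {n} → VSubset n → Set
Proper S = (∃ λ v → S v ≡ true) × (∃ λ v → S v ≡ false)

count-pos : ∀ {n} (S : VSubset n) v → S v ≡ true → 0 < count S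
count-pos {suc n} S zero eq with S zero
... | true = z<s
count-pos {suc n} S (suc v) eq with S zero
... | true  = z<s
... | false = count-pos (λ w → S (suc w)) v eq

not-true : ∀ {b} → b ≡ false → not b ≡ true
not-true refl = refl

minSize : ∀ {n} → VSubset n → ℕ
minSize S = count S ⊓ count (compl S)

minSize-pos : ∀ {n} (S : VSubset n) → Proper S → 0 < minSize S
minSize-pos S ((v , sv) , (w , sw)) =
  ⊓-pres-m< (count-pos S v sv) (count-pos (compl S) w (not-true sw))

ratio : ∀ {n} → Graph n → (S : VSubset n) → Proper S → ℚ
ratio G S p = _/_ (+ count (boundary G S)) (minSize S) {{>-nonZero (minSize-pos S p)}}

IsCheeger : ∀ {n} → Graph n → ℚ → Set
IsCheeger G g =
  (∃ λ S → Σ (Proper S) λ p → g ≡ ratio G S p)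
  × (∀ S (p : Proper S) → g Data.Rational.≤ ratio G S p)

-- position of each of k lions at each time
Schedule : ℕ → ℕ → Set
Schedule n k = ℕ → Fin k → Fin n

ValidStep : ∀ {n k} → Graph n → Schedule n k → ℕ → Set
ValidStep G pos t = ∀ i → pos (suc t) i ≡ pos t i ⊎ Adj G (pos t i) (pos (suc t) i)

PoliteStep : ∀ {n k} → Schedule n k → ℕ → Set
PoliteStep pos t = ∀ i j → pos (suc t) i ≢ pos t i → pos (suc t) j ≢ pos t j → i ≡ j

PoliteSchedule : ∀ {n k} → Graph n → Schedule n k → Set
PoliteSchedule G pos = ∀ t → ValidStep G pos t × PoliteStep pos t

Occupied : ∀ {n k} → Schedule n k → ℕ → Fin n → Set
Occupied pos t v = ∃ λ i → pos t i ≡ v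

Cleared : ∀ {n k} → Graph n → Schedule n k → ℕ → Fin n → Set
Cleared G pos zero    v = Occupied pos zero v
Cleared G pos (suc t) v =
  Occupied pos (suc t) v
  ⊎ (Cleared G pos t v
     × (∀ u → Adj G v u → ¬ Cleared G pos t u →
          ∃ λ i → pos t i ≡ v × pos (suc t) i ≡ u))

AllCleared : ∀ {n k} → Graph n → Schedule n k → ℕ → Set
AllCleared G pos t = ∀ v → Cleared G pos t v

-- A newly cleared vertex must hold a lion that has just moved, so under polite moves the
-- cleared set gains at most one vertex per step. Testing the Cheeger constant on a singleton
-- gives 2k ≤ m := ⌊n/2⌋, hence k < m. The cleared set starts with at most k vertices and ends
-- with all n, so at some step it grows to exactly m vertices; having grown while gaining at
-- most one vertex, it lost none, and then every vertex of its boundary holds a lion, so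
-- |∂S| ≤ k. For this balanced set the Cheeger bound reads 2k·m ≤ m·|∂S| ≤ m·k, impossible
-- as k ≥ 1.

module Submission where

module Subsets where

  open import Defs
  open import Data.Nat using (zero; suc; _+_; _≤_; _<_; z≤n; s≤s; _⊓_)
  open import Data.Nat.Properties hiding (_≟_)
  open import Data.Nat.DivMod using (_/_; m/n*n≤m; m≥n⇒m/n>0)
  open import Data.Bool using (true; false; _∧_; not)
  open import Data.Bool.Properties using (∧-conicalˡ; ∧-conicalʳ; not-injective; T-≡)
  open import Data.Fin using (Fin; zero; suc)
  open import Data.Fin.Properties using (_≟_)
  import Data.Fin.Properties as Fin
  open import Data.List using (allFin)
  open import Data.List.Relation.Unary.Any using (satisfied)
  open import Data.List.Relation.Unary.Any.Properties using (any⁻)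
  open import Data.Product using (∃; _×_; _,_)
  open import Function using (_∘_; Equivalence)
  open import Relation.Binary.PropositionalEquality
  open import Relation.Nullary using (yes; does; contradiction)
  open import Relation.Nullary.Decidable using (dec-true; dec-false)

  _─_ : ∀ {n} → VSubset n → VSubset n → VSubset n
  (S ─ T) v = S v ∧ not (T v)

  _⊆_ : ∀ {n} → VSubset n → VSubset n → Set
  S ⊆ T = ∀ v → S v ≡ true → T v ≡ true

  AtMostOne : ∀ {n} → VSubset n → Set
  AtMostOne S = ∀ u v → S u ≡ true → S v ≡ true → u ≡ v

  tail : ∀ {n} → VSubset (suc n) → VSubset n
  tail S v = S (suc v)

  ∧-not⁻ : ∀ {a b} → a ∧ not b ≡ true → a ≡ true × b ≡ false
  ∧-not⁻ {a} {b} e = ∧-conicalˡ a (not b) e , not-injective (∧-conicalʳ a (not b) e)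

  ─⁺ : ∀ {n} {S T : VSubset n} {v} → S v ≡ true → T v ≡ false → (S ─ T) v ≡ true
  ─⁺ Sv Tv = cong₂ (λ a b → a ∧ not b) Sv Tv

  count-∅ : ∀ {n} (S : VSubset n) → (∀ v → S v ≡ false) → count S ≡ 0
  count-∅ {zero}  S _     = refl
  count-∅ {suc n} S empty rewrite empty zero = count-∅ (tail S) (empty ∘ suc)

  count-compl : ∀ {n} (S : VSubset n) → count S + count (compl S) ≡ n
  count-compl {zero}  S = refl
  count-compl {suc n} S with S zero | count-compl (tail S)
  ... | true  | ih = cong suc ih
  ... | false | ih = trans (+-suc _ _) (cong suc ih)

  count-─ : ∀ {n} (S T : VSubset n) → count S + count (T ─ S) ≡ count T + count (S ─ T)
  count-─ {zero}  S T = refl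
  count-─ {suc n} S T with S zero | T zero | count-─ (tail S) (tail T)
  ... | true  | true  | ih = cong suc ih
  ... | true  | false | ih = trans (cong suc ih) (sym (+-suc _ _))
  ... | false | true  | ih = trans (+-suc _ _) (cong suc ih)
  ... | false | false | ih = ih

  count>0⇒nonempty : ∀ {n} (S : VSubset n) → 0 < count S → ∃ λ v → S v ≡ true
  count>0⇒nonempty {suc n} S pos with S zero in S0
  ... | true  = zero , S0
  ... | false with count>0⇒nonempty (tail S) pos
  ...   | v , Sv = suc v , Sv

  count≤1 : ∀ {n} (S : VSubset n) → AtMostOne S → count S ≤ 1
  count≤1 {zero}  S _   = z≤n
  count≤1 {suc n} S one with S zero in S0
  ... | true  = s≤s (≤-reflexive (count-∅ (tail S) only-zero))
    where
    only-zero : ∀ v → S (suc v) ≡ false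
    only-zero v with S (suc v) in Sv
    ... | true  = contradiction (one zero (suc v) S0 Sv) Fin.0≢1+n
    ... | false = refl
  ... | false = count≤1 (tail S) (λ u v Su Sv → Fin.suc-injective (one (suc u) (suc v) Su Sv))

  ⊆-false : ∀ {n} {S T : VSubset n} → S ⊆ T → ∀ {v} → T v ≡ false → S v ≡ false
  ⊆-false {S = S} S⊆T {v} Tv with S v in Sv
  ... | true  = trans (sym (S⊆T v Sv)) Tv
  ... | false = refl

  ─-empty : ∀ {n} {S T : VSubset n} → S ⊆ T → ∀ v → (S ─ T) v ≡ false
  ─-empty {S = S} S⊆T v with S v in Sv
  ... | false = refl
  ... | true rewrite S⊆T v Sv = refl

  count-⊆ : ∀ {n} (S T : VSubset n) → S ⊆ T → count S ≤ count T
  count-⊆ S T S⊆T = begin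
    count S                     ≤⟨ m≤m+n _ _ ⟩
    count S + count (T ─ S)     ≡⟨ count-─ S T ⟩
    count T + count (S ─ T)     ≡⟨ cong (count T +_) (count-∅ (S ─ T) (─-empty S⊆T)) ⟩
    count T + 0                 ≡⟨ +-identityʳ _ ⟩
    count T                     ∎
    where open ≤-Reasoning

  count≤suc : ∀ {n} (S T : VSubset n) → AtMostOne (S ─ T) → count S ≤ suc (count T)
  count≤suc S T one = begin
    count S                     ≤⟨ m≤m+n _ _ ⟩
    count S + count (T ─ S)     ≡⟨ count-─ S T ⟩
    count T + count (S ─ T)     ≤⟨ +-monoʳ-≤ (count T) (count≤1 (S ─ T) one) ⟩
    count T + 1                 ≡⟨ +-comm (count T) 1 ⟩
    suc (count T)               ∎
    where open ≤-Reasoning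

  count-<⇒⊆ : ∀ {n} (S T : VSubset n) → AtMostOne (S ─ T) → count T < count S → T ⊆ S
  count-<⇒⊆ S T one T<S v Tv with S v in Sv
  ... | true  = refl
  ... | false = contradiction T<S (≤⇒≯ S≤T)
    where
    open ≤-Reasoning
    S≤T : count S ≤ count T
    S≤T = +-cancelʳ-≤ 1 (count S) (count T) (begin
      count S + 1                 ≤⟨ +-monoʳ-≤ (count S) (count-pos (T ─ S) v (─⁺ {S = T} {S} Tv Sv)) ⟩
      count S + count (T ─ S)     ≡⟨ count-─ S T ⟩
      count T + count (S ─ T)     ≤⟨ +-monoʳ-≤ (count T) (count≤1 (S ─ T) one) ⟩
      count T + 1                 ∎)

  balanced-proper : ∀ {n m} (S : VSubset n) → count S ≡ m → 0 < m → m + m ≤ n →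
    Proper S × minSize S ≡ m
  balanced-proper {n} {m} S ∣S∣≡m 0<m 2m≤n =
    (count>0⇒nonempty S (subst (0 <_) (sym ∣S∣≡m) 0<m) , outside) ,
    trans (cong (_⊓ count (compl S)) ∣S∣≡m) (m≤n⇒m⊓n≡m m≤∣S̄∣)
    where
    m≤∣S̄∣ : m ≤ count (compl S)
    m≤∣S̄∣ = +-cancelˡ-≤ m m _
      (subst (m + m ≤_) (trans (sym (count-compl S)) (cong (_+ count (compl S)) ∣S∣≡m)) 2m≤n)
    outside : ∃ λ v → S v ≡ false
    outside with count>0⇒nonempty (compl S) (<-≤-trans 0<m m≤∣S̄∣)
    ... | v , S̄v = v , not-injective S̄v

  half-proper : ∀ {n} (S : VSubset n) → 2 ≤ n → count S ≡ n / 2 → Proper S × minSize S ≡ n / 2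
  half-proper {n} S 2≤n ∣S∣≡n/2 = balanced-proper S ∣S∣≡n/2 (m≥n⇒m/n>0 2≤n) n/2+n/2≤n
    where
    n/2+n/2≤n : n / 2 + n / 2 ≤ n
    n/2+n/2≤n = subst (_≤ n) (trans (*-comm (n / 2) 2) (cong (n / 2 +_) (+-identityʳ (n / 2))))
                  (m/n*n≤m n 2)

  boundary-⊆ : ∀ {n} (G : Graph n) (S : VSubset n) → boundary G S ⊆ S
  boundary-⊆ G S v ∂v = ∧-conicalˡ (S v) _ ∂v

  boundary⁻ : ∀ {n} (G : Graph n) (S : VSubset n) {v} → boundary G S v ≡ true →
    S v ≡ true × ∃ λ u → Adj G v u × S u ≡ false
  boundary⁻ {n} G S {v} ∂v with any⁻ p (allFin n) (Equivalence.from T-≡ (∧-conicalʳ (S v) _ ∂v))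
    where p = λ u → adj G v u ∧ not (S u)
  ... | witness with satisfied witness
  ...   | u , pu = boundary-⊆ G S v ∂v , u , ∧-not⁻ (Equivalence.to T-≡ pu)

  atMostOne-⊆ : ∀ {n} {S T : VSubset n} → S ⊆ T → AtMostOne T → AtMostOne S
  atMostOne-⊆ S⊆T one u v Su Sv = one u v (S⊆T u Su) (S⊆T v Sv)

  ⁅_⁆ : ∀ {n} → Fin n → VSubset n
  ⁅ v ⁆ u = does (u ≟ v)

  ⁅⁆-atMostOne : ∀ {n} (v : Fin n) → AtMostOne ⁅ v ⁆
  ⁅⁆-atMostOne v u w u∈ w∈ with u ≟ v | w ≟ v
  ... | yes refl | yes refl = refl

  ⁅⁆-proper : ∀ {n} {v w : Fin n} → v ≢ w → Proper ⁅ v ⁆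
  ⁅⁆-proper {v = v} {w} v≢w = (v , dec-true (v ≟ v) refl) , (w , dec-false (w ≟ v) (v≢w ∘ sym))

module Cheeger where

  open import Defs
  open Subsets
  open import Data.Nat using (ℕ; suc; _*_; _≤_; _<_; NonZero; >-nonZero)
  open import Data.Nat.Properties
  open import Data.Fin using (Fin)
  open import Data.Integer as ℤ using (+_)
  import Data.Integer.Properties as ℤ
  open import Data.Rational as ℚ using (ℚ; toℚᵘ)
  import Data.Rational.Properties as ℚ
  import Data.Rational.Unnormalised as ℚᵘ
  import Data.Rational.Unnormalised.Properties as ℚᵘ
  open import Relation.Binary.PropositionalEquality
  open import Relation.Nullary using (¬_)

  toℚᵘ-/ : ∀ i n .{{_ : NonZero n}} → toℚᵘ (i ℚ./ n) ℚᵘ.≃ (i ℚᵘ./ n)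
  toℚᵘ-/ i (suc n) = ℚ.toℚᵘ-fromℚᵘ (i ℚᵘ./ suc n)

  /1≤/*/⇒≤ : ∀ k m a b c .{{_ : NonZero a}} .{{_ : NonZero c}} →
    (+ k) ℚ./ 1 ℚ.≤ ((+ m) ℚ./ a) ℚ.* ((+ b) ℚ./ c) → k * (a * c) ≤ m * b
  /1≤/*/⇒≤ k m (suc a) b (suc c) k≤mb/ac
    with ℚᵘ.≤-respˡ-≃ (toℚᵘ-/ (+ k) 1)
           (ℚᵘ.≤-respʳ-≃ (ℚᵘ.≃-trans (ℚ.toℚᵘ-homo-* ((+ m) ℚ./ suc a) ((+ b) ℚ./ suc c))
                                     (ℚᵘ.*-cong (toℚᵘ-/ (+ m) (suc a)) (toℚᵘ-/ (+ b) (suc c))))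
                         (ℚ.toℚᵘ-mono-≤ k≤mb/ac))
  ... | ℚᵘ.*≤* cross = ℤ.drop‿+≤+ (subst₂ ℤ._≤_ lhs rhs cross)
    where
    lhs : + k ℤ.* (+ suc a ℤ.* + suc c) ≡ + (k * (suc a * suc c))
    lhs = trans (cong (+ k ℤ.*_) (sym (ℤ.pos-* (suc a) (suc c)))) (sym (ℤ.pos-* k _))
    rhs : (+ m ℤ.* + b) ℤ.* + 1 ≡ + (m * b)
    rhs = trans (ℤ.*-identityʳ _) (sym (ℤ.pos-* m b))

  k<2*k : ∀ {k} → 0 < k → k < 2 * k
  k<2*k {k} 0<k = m<m+n k (<-≤-trans 0<k (m≤m+n k 0))

  module _ {n} (G : Graph n) {g : ℚ} (g≤ratio : ∀ S (p : Proper S) → g ℚ.≤ ratio G S p)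
           {k m : ℕ} (k≤mg/2 : (+ k) ℚ./ 1 ℚ.≤ ((+ m) ℚ./ 2) ℚ.* g) where

    2*k*minSize≤m*∣∂∣ : ∀ S (p : Proper S) → 2 * k * minSize S ≤ m * count (boundary G S)
    2*k*minSize≤m*∣∂∣ S p = subst (_≤ m * count (boundary G S)) reassoc
      (/1≤/*/⇒≤ k m 2 (count (boundary G S)) (minSize S)
        (ℚ.≤-trans k≤mg/2 (ℚ.*-monoˡ-≤-nonNeg ((+ m) ℚ./ 2) {{ℚ.normalize-nonNeg m 2}} (g≤ratio S p))))
      where
      instance
        nonZero : NonZero (minSize S)
        nonZero = >-nonZero (minSize-pos S p)
      reassoc : k * (2 * minSize S) ≡ 2 * k * minSize S
      reassoc = trans (sym (*-assoc k 2 _)) (cong (_* minSize S) (*-comm k 2))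

    2*k≤m : ∀ {v w : Fin n} → v ≢ w → 2 * k ≤ m
    2*k≤m {v} v≢w = begin
      2 * k                          ≡⟨ sym (*-identityʳ (2 * k)) ⟩
      2 * k * 1                      ≤⟨ *-monoʳ-≤ (2 * k) (minSize-pos ⁅ v ⁆ proper) ⟩
      2 * k * minSize ⁅ v ⁆          ≤⟨ 2*k*minSize≤m*∣∂∣ ⁅ v ⁆ proper ⟩
      m * count (boundary G ⁅ v ⁆)   ≤⟨ *-monoʳ-≤ m (count≤1 _ ∂⁅v⁆-atMostOne) ⟩
      m * 1                          ≡⟨ *-identityʳ m ⟩
      m                              ∎
      where
      open ≤-Reasoning
      proper : Proper ⁅ v ⁆
      proper = ⁅⁆-proper v≢w
      ∂⁅v⁆-atMostOne : AtMostOne (boundary G ⁅ v ⁆)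
      ∂⁅v⁆-atMostOne = atMostOne-⊆ (boundary-⊆ G ⁅ v ⁆) (⁅⁆-atMostOne v)

    k<m : 0 < k → ∀ {v w : Fin n} → v ≢ w → k < m
    k<m 0<k v≢w = <-≤-trans (k<2*k 0<k) (2*k≤m v≢w)

    ∣∂∣≰k : 0 < k → ∀ S (p : Proper S) → minSize S ≡ m → ¬ count (boundary G S) ≤ k
    ∣∂∣≰k 0<k S p minSize≡m ∣∂S∣≤k =
      ≤⇒≯ (*-cancelʳ-≤ (2 * k) k m {{>-nonZero 0<m}} 2km≤km) (k<2*k 0<k)
      where
      open ≤-Reasoning
      0<m : 0 < m
      0<m = subst (0 <_) minSize≡m (minSize-pos S p)
      2km≤km : 2 * k * m ≤ k * m
      2km≤km = begin
        2 * k * m                  ≡⟨ cong (2 * k *_) minSize≡m ⟨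
        2 * k * minSize S          ≤⟨ 2*k*minSize≤m*∣∂∣ S p ⟩
        m * count (boundary G S)   ≤⟨ *-monoʳ-≤ m ∣∂S∣≤k ⟩
        m * k                      ≡⟨ *-comm m k ⟩
        k * m                      ∎

module Lions where

  open import Defs
  open Subsets
  open import Data.Nat using (ℕ; zero; suc; _+_; _≤_; _<_; s≤s; >-nonZero⁻¹)
  open import Data.Nat.Properties hiding (_≟_)
  open import Data.Bool using (true; false; not)
  open import Data.Bool.Properties using () renaming (_≟_ to _≟ᵇ_)
  open import Data.Fin using (Fin; zero; suc)
  open import Data.Fin.Properties using (_≟_; any?; all?; nonZeroIndex)
  open import Data.Product using (∃; _×_; _,_; proj₂)
  open import Data.Sum using (inj₁; inj₂)
  open import Function using (_∘_)
  open import Relation.Binary.PropositionalEquality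
  open import Relation.Nullary using (¬_; Dec; yes; no; does; contradiction)
  open import Relation.Nullary.Decidable using (dec-true; dec-false; _×-dec_; _⊎-dec_; _→-dec_; ¬?)

  dec-true⁻ : ∀ {A : Set} (a? : Dec A) → does a? ≡ true → A
  dec-true⁻ (yes a) _ = a

  dec-false⁻ : ∀ {A : Set} (a? : Dec A) → does a? ≡ false → ¬ A
  dec-false⁻ a? a?≡false a = contradiction (trans (sym (dec-true a? a)) a?≡false) λ ()

  occupied? : ∀ {n k} (f : Fin k → Fin n) v → Dec (∃ λ i → f i ≡ v)
  occupied? f v = any? λ i → f i ≟ v

  occupancy : ∀ {n k} → (Fin k → Fin n) → VSubset n
  occupancy f v = does (occupied? f v)

  count-occupancy : ∀ {n} k (f : Fin k → Fin n) → count (occupancy f) ≤ k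
  count-occupancy zero    f = ≤-reflexive (count-∅ _ λ v → dec-false (occupied? f v) λ ())
  count-occupancy (suc k) f =
    ≤-trans (count≤suc (occupancy f) (occupancy (f ∘ suc)) one) (s≤s (count-occupancy k (f ∘ suc)))
    where
    only-first : ∀ v → (occupancy f ─ occupancy (f ∘ suc)) v ≡ true → v ≡ f zero
    only-first v e with ∧-not⁻ e
    ... | fv , ¬f∘suc-v with dec-true⁻ (occupied? f v) fv
    ...   | zero  , eq = sym eq
    ...   | suc i , eq = contradiction (i , eq) (dec-false⁻ (occupied? (f ∘ suc) v) ¬f∘suc-v)
    one : AtMostOne (occupancy f ─ occupancy (f ∘ suc))
    one u v eu ev = trans (only-first u eu) (sym (only-first v ev))

  upcrossing : ∀ (f : ℕ → ℕ) {m} → f 0 < m → ∀ t → m ≤ f t → ∃ λ s → f s < m × m ≤ f (suc s)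
  upcrossing f f0<m zero    m≤f0 = contradiction f0<m (≤⇒≯ m≤f0)
  upcrossing f {m} f0<m (suc t) m≤ft with f t <? m
  ... | yes ft<m = t , ft<m , m≤ft
  ... | no  ft≮m = upcrossing f f0<m t (≮⇒≥ ft≮m)

  module Clearing {n k} (G : Graph n) (pos : Schedule n k) where

    cleared? : ∀ t v → Dec (Cleared G pos t v)
    cleared? zero    v = occupied? (pos zero) v
    cleared? (suc t) v = occupied? (pos (suc t)) v ⊎-dec (cleared? t v ×-dec all? λ u →
      (adj G v u ≟ᵇ true) →-dec (¬? (cleared? t u) →-dec
        any? λ i → (pos t i ≟ v) ×-dec (pos (suc t) i ≟ u)))

    C : ℕ → VSubset n
    C t v = does (cleared? t v)

    cleared⇒lion : ∀ t {v} → Cleared G pos t v → Fin k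
    cleared⇒lion zero    (i , _)        = i
    cleared⇒lion (suc t) (inj₁ (i , _)) = i
    cleared⇒lion (suc t) (inj₂ (c , _)) = cleared⇒lion t c

    cleared⇒0<k : ∀ t {v} → Cleared G pos t v → 0 < k
    cleared⇒0<k t c = >-nonZero⁻¹ k {{nonZeroIndex (cleared⇒lion t c)}}

    all-cleared⇒count≡n : ∀ t → AllCleared G pos t → count (C t) ≡ n
    all-cleared⇒count≡n t all = begin
      count (C t)                           ≡⟨ +-identityʳ _ ⟨
      count (C t) + 0                       ≡⟨ cong (count (C t) +_) (count-∅ _ no-contaminated) ⟨
      count (C t) + count (compl (C t))     ≡⟨ count-compl (C t) ⟩
      n                                     ∎
      where
      open ≡-Reasoning
      no-contaminated : ∀ v → compl (C t) v ≡ false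
      no-contaminated v = cong not (dec-true (cleared? t v) (all v))

    occupied⇒cleared : ∀ t v → Occupied pos t v → Cleared G pos t v
    occupied⇒cleared zero    v o = o
    occupied⇒cleared (suc t) v o = inj₁ o

    newly-cleared⇒moved : ∀ t v → (C (suc t) ─ C t) v ≡ true →
      ∃ λ i → pos (suc t) i ≡ v × pos (suc t) i ≢ pos t i
    newly-cleared⇒moved t v e with ∧-not⁻ e
    ... | now , before with dec-true⁻ (cleared? (suc t) v) now
    ...   | inj₂ (was , _) = contradiction was (dec-false⁻ (cleared? t v) before)
    ...   | inj₁ (i , at)  = i , at , λ stayed →
            dec-false⁻ (cleared? t v) before (occupied⇒cleared t v (i , trans (sym stayed) at))

    newly-cleared-atMostOne : ∀ t → PoliteStep pos t → AtMostOne (C (suc t) ─ C t)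
    newly-cleared-atMostOne t polite u v eu ev
      with newly-cleared⇒moved t u eu | newly-cleared⇒moved t v ev
    ... | i , iu , i-moved | j , jv , j-moved with polite i j i-moved j-moved
    ...   | refl = trans (sym iu) jv

    boundary-occupied : ∀ t → C t ⊆ C (suc t) → boundary G (C (suc t)) ⊆ occupancy (pos (suc t))
    boundary-occupied t C⊆C′ v ∂v with boundary⁻ G (C (suc t)) ∂v
    ... | Cv , u , v~u , C′u with dec-true⁻ (cleared? (suc t) v) Cv
    ...   | inj₁ occupied      = dec-true (occupied? (pos (suc t)) v) occupied
    ...   | inj₂ (_ , guarded) with guarded u v~u (dec-false⁻ (cleared? t u) (⊆-false C⊆C′ C′u))
    ...     | j , _ , lands = contradiction (inj₁ (j , lands)) (dec-false⁻ (cleared? (suc t) u) C′u)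

    guarded-set-of-size : PoliteSchedule G pos → ∀ {m} → k < m → m ≤ n → ∀ T → AllCleared G pos T →
      ∃ λ S → count S ≡ m × count (boundary G S) ≤ k
    guarded-set-of-size polite k<m m≤n T all
      with upcrossing (count ∘ C) (≤-<-trans (count-occupancy k (pos zero)) k<m) T
                      (≤-trans m≤n (≤-reflexive (sym (all-cleared⇒count≡n T all))))
    ... | t , before , after = C (suc t) , ≤-antisym (≤-trans grows-by-one before) after ,
          ≤-trans (count-⊆ (boundary G (C (suc t))) (occupancy (pos (suc t))) ∂C⊆occupied)
                  (count-occupancy k (pos (suc t)))
      where
      one : AtMostOne (C (suc t) ─ C t)
      one = newly-cleared-atMostOne t (proj₂ (polite t))
      grows-by-one : count (C (suc t)) ≤ suc (count (C t))
      grows-by-one = count≤suc (C (suc t)) (C t) one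
      ∂C⊆occupied : boundary G (C (suc t)) ⊆ occupancy (pos (suc t))
      ∂C⊆occupied = boundary-occupied t (count-<⇒⊆ (C (suc t)) (C t) one (<-≤-trans before after))

open import Defs
open import Data.Nat using (ℕ; _<_; s≤s)
open import Data.Nat.DivMod using (m/n≤m)
open import Data.Integer using (+_)
open import Data.Rational using (ℚ; _*_)
open import Data.Product using (_,_)
open import Data.Fin using (zero; suc)
open import Relation.Nullary using (¬_)
open Subsets
open Cheeger
open Lions

mainTheorem2 : (n : ℕ) (G : Graph n) → 2 Data.Nat.≤ n → Connected G →
    (g : ℚ) → IsCheeger G g →
    (k : ℕ) → (+ k) Data.Rational./ 1 Data.Rational.≤ ((+ (n Data.Nat.DivMod./ 2)) Data.Rational./ 2) * g →
    (pos : Schedule n k) → PoliteSchedule G pos →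
    ∀ t → ¬ AllCleared G pos t
mainTheorem2 n G 2≤n@(s≤s (s≤s _)) _ g (_ , g≤ratio) k k≤mg/2 pos polite T all-cleared =
  let S , ∣S∣≡n/2 , ∣∂S∣≤k = guarded-set-of-size polite k<n/2 (m/n≤m n 2) T all-cleared
      proper , minSize≡n/2 = half-proper S 2≤n ∣S∣≡n/2
  in ∣∂∣≰k G g≤ratio k≤mg/2 0<k S proper minSize≡n/2 ∣∂S∣≤k
  where
  open Clearing G pos
  0<k : 0 < k
  0<k = cleared⇒0<k T (all-cleared zero)
  k<n/2 : k < n Data.Nat.DivMod./ 2
  k<n/2 = k<m G g≤ratio k≤mg/2 0<k {zero} {suc zero} λ ()
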